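{- Let $(A,B)$ be an exact $3$-separation of a matroid $M$, let $A'$ be an $A$-strand and $B'$ a $B$-strand. Then $\sqcap(A',B')=1$ if and only if $A'\cup B'$ is a circuit of $M$.
   Context: $\sqcap(U,V)=r(U)+r(V)-r(U\cup V)$. A partition $(A,B)$ of the ground set of $M$ is an exact $3$-separation if $|A|,|B|\ge 3$ and $r(A)+r(B)-r(M)=2$. An $A$-strand is a minimal $A'\subseteq A$ with $\sqcap(A',B)=1$; a $B$-strand is a minimal $B'\subseteq B$ with $\sqcap(B',A)=1$. -}

module Defs where

open import Data.Nat using (ℕ; _+_; _∸_; _≤_; _<_; _≥_)
open import Data.Fin.Subset using (Subset; _⊆_; _⊂_; _∪_; _∩_; ∁; ⊤; ∣_∣)
open import Data.Product using (_×_)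
open import Relation.Binary.PropositionalEquality using (_≡_)
open import Relation.Nullary using (¬_)

record Matroid (n : ℕ) : Set where
  field
    r         : Subset n → ℕ
    r-bounded : ∀ X → r X ≤ ∣ X ∣
    r-mono    : ∀ {X Y} → X ⊆ Y → r X ≤ r Y
    r-submod  : ∀ X Y → r (X ∪ Y) + r (X ∩ Y) ≤ r X + r Y

module _ {n : ℕ} (M : Matroid n) where
  open Matroid M

  -- local connectivity ⊓(U,V) = r(U) + r(V) − r(U ∪ V)  (nonnegative by submodularity)
  ⊓ : Subset n → Subset n → ℕ
  ⊓ U V = (r U + r V) ∸ r (U ∪ V)

  rM : ℕ
  rM = r ⊤

  Independent : Subset n → Set
  Independent X = r X ≡ ∣ X ∣

  Dependent : Subset n → Set
  Dependent X = r X < ∣ X ∣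

  Circuit : Subset n → Set
  Circuit C = Dependent C × (∀ D → D ⊂ C → Independent D)

  Exact3Sep : Subset n → Set
  Exact3Sep A = (∣ A ∣ ≥ 3) × (∣ ∁ A ∣ ≥ 3) × ((r A + r (∁ A)) ∸ rM ≡ 2)

  -- X' is a minimal subset of X with ⊓(X', Y) = 1
  -- (A-strand: X = A, Y = B;  B-strand: X = B, Y = A)
  Strand : Subset n → Subset n → Subset n → Set
  Strand X Y X' = (X' ⊆ X) × (⊓ X' Y ≡ 1) × (∀ X'' → X'' ⊂ X' → ¬ (⊓ X'' Y ≡ 1))

{-# OPTIONS --safe #-}
-- A strand X of (P , Q) is skew to Q after deleting any one of its elements, by
-- minimality and monotonicity of ⊓ in its first argument; hence every element of X
-- is a coloop of X, so X is independent, and X - x ∪ Y is independent for every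
-- independent Y ⊆ Q. If ⊓(X , Y) = 1 then X ∪ Y is dependent while every
-- single-element deletion is independent, so it is a circuit. Conversely a circuit
-- C has r C = ∣ C ∣ - 1, and with X, Y independent and disjoint this says ⊓(X , Y) = 1.
module Submission where

open import Defs
open import Data.Nat using (ℕ)
open import Data.Fin.Subset using (Subset; _∪_; ∁)
open import Function.Bundles using (_⇔_)
open import Relation.Binary.PropositionalEquality using (_≡_)

open import Data.Empty using (⊥-elim)
open import Data.Fin using (Fin; _≟_)
open import Data.Fin.Subset
  using (_∩_; _─_; _-_; _∈_; _∉_; _⊆_; _⊂_; ∣_∣; ⁅_⁆; inside; outside; Empty; Nonempty)
open import Data.Fin.Subset.Properties
  using (x∈p∪q⁺; x∈p∪q⁻; x∈p∩q⁺; x∈p∩q⁻; p⊆p∪q; q⊆p∪q; p─q⊆p; x∈p∧x≢y⇒x∈p-y; x∈p∧x∉q⇒x∈p─q; _∈?_; x∈⁅x⁆;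
         x∉⁅y⁆⇒x≢y; ∣⁅x⁆∣≡1; ∣⊥∣≡0; Empty-unique; nonempty?; x∈p⇒p-x⊂p;
         x∈p⇒∣p-x∣<∣p∣; p⊆q⇒∣p∣≤∣q∣; p⊂q⇒p⊆q; x∈p⇒x∉∁p; p─x─y≡p─y─x; ∪-comm)
open import Data.Nat using (zero; suc; _+_; _∸_; _≤_; _<_; z≤n; s≤s)
open import Data.Nat.Properties hiding (_≟_)
open import Algebra.Properties.CommutativeSemigroup +-commutativeSemigroup using (xy∙z≈xz∙y)
open import Data.Product using (_,_; proj₁; proj₂)
open import Data.Sum using (inj₁; inj₂; [_,_])
open import Data.Vec using (_∷_; []; there)
open import Function.Bundles using (mk⇔)
open import Relation.Nullary using (yes; no)
open import Relation.Binary.PropositionalEquality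
  using (_≢_; refl; sym; trans; cong; cong₂; subst; module ≡-Reasoning)

∣p∪q∣+∣p∩q∣≡∣p∣+∣q∣ : ∀ {n} (p q : Subset n) → ∣ p ∪ q ∣ + ∣ p ∩ q ∣ ≡ ∣ p ∣ + ∣ q ∣
∣p∪q∣+∣p∩q∣≡∣p∣+∣q∣ [] [] = refl
∣p∪q∣+∣p∩q∣≡∣p∣+∣q∣ (inside ∷ p) (inside ∷ q) = cong suc (begin
  ∣ p ∪ q ∣ + suc ∣ p ∩ q ∣   ≡⟨ +-suc ∣ p ∪ q ∣ ∣ p ∩ q ∣ ⟩
  suc (∣ p ∪ q ∣ + ∣ p ∩ q ∣) ≡⟨ cong suc (∣p∪q∣+∣p∩q∣≡∣p∣+∣q∣ p q) ⟩
  suc (∣ p ∣ + ∣ q ∣)         ≡⟨ sym (+-suc ∣ p ∣ ∣ q ∣) ⟩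
  ∣ p ∣ + suc ∣ q ∣           ∎)
  where open ≡-Reasoning
∣p∪q∣+∣p∩q∣≡∣p∣+∣q∣ (inside ∷ p) (outside ∷ q) = cong suc (∣p∪q∣+∣p∩q∣≡∣p∣+∣q∣ p q)
∣p∪q∣+∣p∩q∣≡∣p∣+∣q∣ (outside ∷ p) (inside ∷ q) =
  trans (cong suc (∣p∪q∣+∣p∩q∣≡∣p∣+∣q∣ p q)) (sym (+-suc ∣ p ∣ ∣ q ∣))
∣p∪q∣+∣p∩q∣≡∣p∣+∣q∣ (outside ∷ p) (outside ∷ q) = ∣p∪q∣+∣p∩q∣≡∣p∣+∣q∣ p q

x∈p─q⇒x∉q : ∀ {n} {x : Fin n} (p q : Subset n) → x ∈ p ─ q → x ∉ q
x∈p─q⇒x∉q (_ ∷ p) (_ ∷ q) (there x∈p─q) (there x∈q) = x∈p─q⇒x∉q p q x∈p─q x∈q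

module _ {n : ℕ} where

  Disjoint : Subset n → Subset n → Set
  Disjoint p q = ∀ {x} → x ∈ p → x ∉ q

  ∣Empty∣≡0 : ∀ {p : Subset n} → Empty p → ∣ p ∣ ≡ 0
  ∣Empty∣≡0 p-empty = trans (cong ∣_∣ (Empty-unique p-empty)) (∣⊥∣≡0 n)

  ∣p∪q∣≤∣p∣+∣q∣ : ∀ (p q : Subset n) → ∣ p ∪ q ∣ ≤ ∣ p ∣ + ∣ q ∣
  ∣p∪q∣≤∣p∣+∣q∣ p q = subst (∣ p ∪ q ∣ ≤_) (∣p∪q∣+∣p∩q∣≡∣p∣+∣q∣ p q) (m≤m+n _ _)

  Disjoint⇒∣p∪q∣≡∣p∣+∣q∣ : ∀ {p q : Subset n} → Disjoint p q → ∣ p ∪ q ∣ ≡ ∣ p ∣ + ∣ q ∣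
  Disjoint⇒∣p∪q∣≡∣p∣+∣q∣ {p} {q} p#q = begin
    ∣ p ∪ q ∣                 ≡⟨ sym (+-identityʳ _) ⟩
    ∣ p ∪ q ∣ + 0             ≡⟨ cong (∣ p ∪ q ∣ +_) (sym (∣Empty∣≡0 p∩q-empty)) ⟩
    ∣ p ∪ q ∣ + ∣ p ∩ q ∣     ≡⟨ ∣p∪q∣+∣p∩q∣≡∣p∣+∣q∣ p q ⟩
    ∣ p ∣ + ∣ q ∣             ∎
    where
    open ≡-Reasoning
    p∩q-empty : Empty (p ∩ q)
    p∩q-empty (x , x∈p∩q) = let (x∈p , x∈q) = x∈p∩q⁻ p q x∈p∩q in p#q x∈p x∈q

  p⊆p-x∪q : ∀ {p q : Subset n} {x} → x ∈ q → p ⊆ (p - x) ∪ q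
  p⊆p-x∪q {x = x} x∈q {y} y∈p with y ≟ x
  ... | yes refl = x∈p∪q⁺ (inj₂ x∈q)
  ... | no y≢x   = x∈p∪q⁺ (inj₁ (x∈p∧x≢y⇒x∈p-y y∈p y≢x))

  ∣p∣≤1+∣p-x∣ : ∀ (p : Subset n) x → ∣ p ∣ ≤ suc ∣ p - x ∣
  ∣p∣≤1+∣p-x∣ p x = begin
    ∣ p ∣                     ≤⟨ p⊆q⇒∣p∣≤∣q∣ (p⊆p-x∪q {p = p} (x∈⁅x⁆ x)) ⟩
    ∣ (p - x) ∪ ⁅ x ⁆ ∣       ≤⟨ ∣p∪q∣≤∣p∣+∣q∣ (p - x) ⁅ x ⁆ ⟩
    ∣ p - x ∣ + ∣ ⁅ x ⁆ ∣     ≡⟨ cong (∣ p - x ∣ +_) (∣⁅x⁆∣≡1 x) ⟩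
    ∣ p - x ∣ + 1             ≡⟨ +-comm ∣ p - x ∣ 1 ⟩
    suc ∣ p - x ∣             ∎
    where open ≤-Reasoning

  x∈p-y⇒x≢y : ∀ {p : Subset n} {x y} → x ∈ p - y → x ≢ y
  x∈p-y⇒x≢y {p} {y = y} x∈p-y = x∉⁅y⁆⇒x≢y (x∈p─q⇒x∉q p ⁅ y ⁆ x∈p-y)

  p⊆q∧x∉p⇒p⊆q-x : ∀ {p q : Subset n} {x} → p ⊆ q → x ∉ p → p ⊆ q - x
  p⊆q∧x∉p⇒p⊆q-x p⊆q x∉p y∈p = x∈p∧x≢y⇒x∈p-y (p⊆q y∈p) λ { refl → x∉p y∈p }

  p∪q-x⊆p-x∪q : ∀ (p q : Subset n) x → (p ∪ q) - x ⊆ (p - x) ∪ q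
  p∪q-x⊆p-x∪q p q x y∈p∪q-x =
    [ (λ y∈p → x∈p∪q⁺ (inj₁ (x∈p∧x≢y⇒x∈p-y y∈p (x∈p-y⇒x≢y y∈p∪q-x)))) , (λ y∈q → x∈p∪q⁺ (inj₂ y∈q)) ]
      (x∈p∪q⁻ p q (p─q⊆p (p ∪ q) ⁅ x ⁆ y∈p∪q-x))

  ∪-monoˡ-⊆ : ∀ {p q : Subset n} (s : Subset n) → p ⊆ q → p ∪ s ⊆ q ∪ s
  ∪-monoˡ-⊆ {p} s p⊆q y∈p∪s = [ (λ y∈p → x∈p∪q⁺ (inj₁ (p⊆q y∈p))) , (λ y∈s → x∈p∪q⁺ (inj₂ y∈s)) ]
    (x∈p∪q⁻ p s y∈p∪s)

∸-mono-cross : ∀ {a b c d q} → d + a ≤ c + b → d ≤ c + q → (a + q) ∸ b ≤ (c + q) ∸ d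
∸-mono-cross {a} {b} {c} {d} {q} d+a≤c+b d≤c+q = m≤n+o⇒m∸n≤o (a + q) b (+-cancelʳ-≤ d _ _ (begin
  (a + q) + d   ≡⟨ xy∙z≈xz∙y a q d ⟩
  (a + d) + q   ≡⟨ cong (_+ q) (+-comm a d) ⟩
  (d + a) + q   ≤⟨ +-monoˡ-≤ q d+a≤c+b ⟩
  (c + b) + q   ≡⟨ xy∙z≈xz∙y c b q ⟩
  (c + q) + b   ≡⟨ cong (_+ b) (sym (m∸n+n≡m d≤c+q)) ⟩
  (e + d) + b   ≡⟨ xy∙z≈xz∙y e d b ⟩
  (e + b) + d   ≡⟨ cong (_+ d) (+-comm e b) ⟩
  (b + e) + d   ∎))
  where
  open ≤-Reasoning
  e = (c + q) ∸ d

module _ {n : ℕ} (M : Matroid n) where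
  open Matroid M

  Skew : Subset n → Subset n → Set
  Skew U V = r U + r V ≤ r (U ∪ V)

  AllColoops : Subset n → Set
  AllColoops X = ∀ {e} → e ∈ X → r (X - e) < r X

  r-submod-⊆ : ∀ {S T P Q} → S ⊆ P ∪ Q → T ⊆ P ∩ Q → r S + r T ≤ r P + r Q
  r-submod-⊆ {P = P} {Q} S⊆P∪Q T⊆P∩Q = ≤-trans (+-mono-≤ (r-mono S⊆P∪Q) (r-mono T⊆P∩Q)) (r-submod P Q)

  r-subadditive : ∀ U V → r (U ∪ V) ≤ r U + r V
  r-subadditive U V = ≤-trans (m≤m+n _ _) (r-submod U V)

  ⊓≡1⇒ : ∀ {U V} → ⊓ M U V ≡ 1 → r U + r V ≡ suc (r (U ∪ V))
  ⊓≡1⇒ {U} {V} ⊓≡1 = trans (sym (m∸n+n≡m (r-subadditive U V))) (cong (_+ r (U ∪ V)) ⊓≡1)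

  ⊓≡1⇐ : ∀ {U V} → r U + r V ≡ suc (r (U ∪ V)) → ⊓ M U V ≡ 1
  ⊓≡1⇐ {U} {V} eq = trans (cong (_∸ r (U ∪ V)) (trans eq (+-comm 1 _))) (m+n∸m≡n (r (U ∪ V)) 1)

  ⊓-monoˡ : ∀ {Z X} Q → Z ⊆ X → ⊓ M Z Q ≤ ⊓ M X Q
  ⊓-monoˡ {Z} {X} Q Z⊆X = ∸-mono-cross {b = r (Z ∪ Q)} {c = r X} {q = r Q}
    (r-submod-⊆ X∪Q⊆X∪[Z∪Q] Z⊆X∩[Z∪Q]) (r-subadditive X Q)
    where
    X∪Q⊆X∪[Z∪Q] : X ∪ Q ⊆ X ∪ (Z ∪ Q)
    X∪Q⊆X∪[Z∪Q] y∈X∪Q = [ (λ y∈X → x∈p∪q⁺ (inj₁ y∈X)) , (λ y∈Q → x∈p∪q⁺ (inj₂ (q⊆p∪q Z Q y∈Q))) ]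
      (x∈p∪q⁻ X Q y∈X∪Q)
    Z⊆X∩[Z∪Q] : Z ⊆ X ∩ (Z ∪ Q)
    Z⊆X∩[Z∪Q] y∈Z = x∈p∩q⁺ (Z⊆X y∈Z , p⊆p∪q Q y∈Z)

  Skew-⊆ʳ : ∀ {U V W} → Skew U V → W ⊆ V → Skew U W
  Skew-⊆ʳ {U} {V} {W} skew W⊆V = +-cancelʳ-≤ (r V) _ _ (begin
    (r U + r W) + r V   ≡⟨ xy∙z≈xz∙y (r U) (r W) (r V) ⟩
    (r U + r V) + r W   ≤⟨ +-monoˡ-≤ (r W) skew ⟩
    r (U ∪ V) + r W     ≤⟨ r-submod-⊆ U∪V⊆[U∪W]∪V W⊆[U∪W]∩V ⟩
    r (U ∪ W) + r V     ∎)
    where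
    open ≤-Reasoning
    U∪V⊆[U∪W]∪V : U ∪ V ⊆ (U ∪ W) ∪ V
    U∪V⊆[U∪W]∪V = ∪-monoˡ-⊆ V (p⊆p∪q W)
    W⊆[U∪W]∩V : W ⊆ (U ∪ W) ∩ V
    W⊆[U∪W]∩V y∈W = x∈p∩q⁺ (q⊆p∪q U W y∈W , W⊆V y∈W)

  Independent-⊆ : ∀ {D I} → D ⊆ I → Independent M I → Independent M D
  Independent-⊆ {D} {I} D⊆I I-indep = ≤-antisym (r-bounded D) (+-cancelʳ-≤ ∣ I ─ D ∣ _ _ (begin
    ∣ D ∣ + ∣ I ─ D ∣       ≡⟨ sym (Disjoint⇒∣p∪q∣≡∣p∣+∣q∣ λ y∈D y∈I─D → x∈p─q⇒x∉q I D y∈I─D y∈D) ⟩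
    ∣ D ∪ (I ─ D) ∣         ≤⟨ p⊆q⇒∣p∣≤∣q∣ D∪[I─D]⊆I ⟩
    ∣ I ∣                   ≡⟨ sym I-indep ⟩
    r I                     ≤⟨ r-mono I⊆D∪[I─D] ⟩
    r (D ∪ (I ─ D))         ≤⟨ r-subadditive D (I ─ D) ⟩
    r D + r (I ─ D)         ≤⟨ +-monoʳ-≤ (r D) (r-bounded (I ─ D)) ⟩
    r D + ∣ I ─ D ∣         ∎))
    where
    open ≤-Reasoning
    D∪[I─D]⊆I : D ∪ (I ─ D) ⊆ I
    D∪[I─D]⊆I y∈D∪[I─D] = [ D⊆I , p─q⊆p I D ] (x∈p∪q⁻ D (I ─ D) y∈D∪[I─D])
    I⊆D∪[I─D] : I ⊆ D ∪ (I ─ D)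
    I⊆D∪[I─D] {y} y∈I with y ∈? D
    ... | yes y∈D = x∈p∪q⁺ (inj₁ y∈D)
    ... | no  y∉D = x∈p∪q⁺ (inj₂ (x∈p∧x∉q⇒x∈p─q y∈I y∉D))

  Skew-Independent-∪ : ∀ {U V} → Independent M U → Independent M V → Skew U V → Independent M (U ∪ V)
  Skew-Independent-∪ {U} {V} U-indep V-indep skew = ≤-antisym (r-bounded (U ∪ V)) (begin
    ∣ U ∪ V ∣       ≤⟨ ∣p∪q∣≤∣p∣+∣q∣ U V ⟩
    ∣ U ∣ + ∣ V ∣   ≡⟨ sym (cong₂ _+_ U-indep V-indep) ⟩
    r U + r V       ≤⟨ skew ⟩
    r (U ∪ V)       ∎)
    where open ≤-Reasoning

  Independent-insert-coloop : ∀ {X e} → e ∈ X → Independent M (X - e) → r (X - e) < r X → Independent M X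
  Independent-insert-coloop {X} {e} e∈X X-e-indep coloop = ≤-antisym (r-bounded X) (begin
    ∣ X ∣             ≤⟨ ∣p∣≤1+∣p-x∣ X e ⟩
    suc ∣ X - e ∣     ≡⟨ cong suc (sym X-e-indep) ⟩
    suc (r (X - e))   ≤⟨ coloop ⟩
    r X               ∎)
    where open ≤-Reasoning

  AllColoops-delete : ∀ {X e} → e ∈ X → AllColoops X → AllColoops (X - e)
  AllColoops-delete {X} {e} e∈X coloops {f} f∈X-e = +-cancelˡ-< (r X) _ _ (begin-strict
    r X + r (X - e - f)     ≤⟨ r-submod-⊆ (p⊆p-x∪q e∈X-f) X-e-f⊆[X-e]∩[X-f] ⟩
    r (X - e) + r (X - f)   <⟨ +-monoʳ-< (r (X - e)) (coloops (p─q⊆p X ⁅ e ⁆ f∈X-e)) ⟩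
    r (X - e) + r X         ≡⟨ +-comm (r (X - e)) (r X) ⟩
    r X + r (X - e)         ∎)
    where
    open ≤-Reasoning
    e∈X-f : e ∈ X - f
    e∈X-f = x∈p∧x≢y⇒x∈p-y e∈X λ e≡f → x∈p-y⇒x≢y f∈X-e (sym e≡f)
    X-e-f⊆[X-e]∩[X-f] : X - e - f ⊆ (X - e) ∩ (X - f)
    X-e-f⊆[X-e]∩[X-f] {y} y∈X-e-f = x∈p∩q⁺
      (p─q⊆p (X - e) ⁅ f ⁆ y∈X-e-f , p─q⊆p (X - f) ⁅ e ⁆ (subst (y ∈_) (p─x─y≡p─y─x X e f) y∈X-e-f))

  AllColoops⇒Independent : ∀ {X} → AllColoops X → Independent M X
  AllColoops⇒Independent {X} = go ∣ X ∣ X ≤-refl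
    where
    go : ∀ k X → ∣ X ∣ ≤ k → AllColoops X → Independent M X
    go zero    X ∣X∣≤0 _ = ≤-antisym (r-bounded X) (≤-trans ∣X∣≤0 z≤n)
    go (suc k) X ∣X∣≤1+k coloops with nonempty? X
    ... | no  X-empty     = go zero X (≤-reflexive (∣Empty∣≡0 X-empty)) coloops
    ... | yes (e , e∈X)   = Independent-insert-coloop e∈X
      (go k (X - e) (≤-pred (≤-trans (x∈p⇒∣p-x∣<∣p∣ e∈X) ∣X∣≤1+k)) (AllColoops-delete e∈X coloops))
      (coloops e∈X)

  Dependent⇒Nonempty : ∀ {C} → Dependent M C → Nonempty C
  Dependent⇒Nonempty {C} C-dep with nonempty? C
  ... | yes C-nonempty = C-nonempty
  ... | no  C-empty    = ⊥-elim (n≮0 (subst (r C <_) (∣Empty∣≡0 C-empty) C-dep))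

  Circuit⇒1+r≡∣∣ : ∀ {C} → Circuit M C → suc (r C) ≡ ∣ C ∣
  Circuit⇒1+r≡∣∣ {C} (C-dep , C-minimal) = ≤-antisym C-dep (begin
    ∣ C ∣               ≤⟨ ∣p∣≤1+∣p-x∣ C a ⟩
    suc ∣ C - a ∣       ≡⟨ cong suc (sym (C-minimal (C - a) (x∈p⇒p-x⊂p a∈C))) ⟩
    suc (r (C - a))     ≤⟨ s≤s (r-mono (p─q⊆p C ⁅ a ⁆)) ⟩
    suc (r C)           ∎)
    where
    open ≤-Reasoning
    a = proj₁ (Dependent⇒Nonempty C-dep)
    a∈C = proj₂ (Dependent⇒Nonempty C-dep)

  Independent-deletions⇒Circuit : ∀ {C} → Dependent M C → (∀ {x} → x ∈ C → Independent M (C - x)) →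
                                  Circuit M C
  Independent-deletions⇒Circuit C-dep deletions-indep =
    C-dep , λ { D (D⊆C , x , x∈C , x∉D) → Independent-⊆ (p⊆q∧x∉p⇒p⊆q-x D⊆C x∉D) (deletions-indep x∈C) }

  module _ {P Q X : Subset n} (strand : Strand M P Q X) where

    private
      ⊓XQ≡1 : ⊓ M X Q ≡ 1
      ⊓XQ≡1 = proj₁ (proj₂ strand)

    strand-⊂-Skew : ∀ {Z} → Z ⊂ X → Skew Z Q
    strand-⊂-Skew {Z} Z⊂X with n≤1⇒n≡0∨n≡1 (subst (⊓ M Z Q ≤_) ⊓XQ≡1 (⊓-monoˡ Q (p⊂q⇒p⊆q Z⊂X)))
    ... | inj₁ ⊓ZQ≡0 = m∸n≡0⇒m≤n ⊓ZQ≡0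
    ... | inj₂ ⊓ZQ≡1 = ⊥-elim (proj₂ (proj₂ strand) Z Z⊂X ⊓ZQ≡1)

    strand-Independent : Independent M X
    strand-Independent = AllColoops⇒Independent λ {e} e∈X → +-cancelʳ-< (r Q) _ _ (begin-strict
      r (X - e) + r Q     ≤⟨ strand-⊂-Skew (x∈p⇒p-x⊂p e∈X) ⟩
      r ((X - e) ∪ Q)     ≤⟨ r-mono (∪-monoˡ-⊆ Q (p─q⊆p X ⁅ e ⁆)) ⟩
      r (X ∪ Q)           <⟨ n<1+n _ ⟩
      suc (r (X ∪ Q))     ≡⟨ sym (⊓≡1⇒ ⊓XQ≡1) ⟩
      r X + r Q           ∎)
      where open ≤-Reasoning

    strand-delete-∪-Independent : ∀ {Y x} → Y ⊆ Q → Independent M Y → x ∈ X → Independent M ((X - x) ∪ Y)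
    strand-delete-∪-Independent {Y} {x} Y⊆Q Y-indep x∈X = Skew-Independent-∪
      (Independent-⊆ (p─q⊆p X ⁅ x ⁆) strand-Independent) Y-indep
      (Skew-⊆ʳ (strand-⊂-Skew (x∈p⇒p-x⊂p x∈X)) Y⊆Q)

  ⊓-strands≡1⇔Circuit : ∀ {P Q X Y} → Disjoint P Q → Strand M P Q X → Strand M Q P Y →
                         (⊓ M X Y ≡ 1) ⇔ Circuit M (X ∪ Y)
  ⊓-strands≡1⇔Circuit {P} {Q} {X} {Y} P#Q X-strand Y-strand = mk⇔ ⊓≡1⇒Circuit Circuit⇒⊓≡1
    where
    X⊆P = proj₁ X-strand
    Y⊆Q = proj₁ Y-strand
    X#Y : Disjoint X Y
    X#Y x∈X x∈Y = P#Q (X⊆P x∈X) (Y⊆Q x∈Y)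
    X-indep = strand-Independent X-strand
    Y-indep = strand-Independent Y-strand

    ⊓≡1⇒Circuit : ⊓ M X Y ≡ 1 → Circuit M (X ∪ Y)
    ⊓≡1⇒Circuit ⊓XY≡1 = Independent-deletions⇒Circuit X∪Y-dep deletion-indep
      where
      X∪Y-dep : Dependent M (X ∪ Y)
      X∪Y-dep = begin-strict
        r (X ∪ Y)           <⟨ n<1+n _ ⟩
        suc (r (X ∪ Y))     ≡⟨ sym (⊓≡1⇒ ⊓XY≡1) ⟩
        r X + r Y           ≡⟨ cong₂ _+_ X-indep Y-indep ⟩
        ∣ X ∣ + ∣ Y ∣       ≡⟨ sym (Disjoint⇒∣p∪q∣≡∣p∣+∣q∣ X#Y) ⟩
        ∣ X ∪ Y ∣           ∎
        where open ≤-Reasoning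
      deletion-indep : ∀ {x} → x ∈ X ∪ Y → Independent M ((X ∪ Y) - x)
      deletion-indep {x} x∈X∪Y with x∈p∪q⁻ X Y x∈X∪Y
      ... | inj₁ x∈X = Independent-⊆ (p∪q-x⊆p-x∪q X Y x)
        (strand-delete-∪-Independent X-strand Y⊆Q Y-indep x∈X)
      ... | inj₂ x∈Y = Independent-⊆ (subst (λ S → S - x ⊆ (Y - x) ∪ X) (∪-comm Y X) (p∪q-x⊆p-x∪q Y X x))
        (strand-delete-∪-Independent Y-strand X⊆P X-indep x∈Y)

    Circuit⇒⊓≡1 : Circuit M (X ∪ Y) → ⊓ M X Y ≡ 1
    Circuit⇒⊓≡1 X∪Y-circuit = ⊓≡1⇐ (begin
      r X + r Y           ≡⟨ cong₂ _+_ X-indep Y-indep ⟩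
      ∣ X ∣ + ∣ Y ∣       ≡⟨ sym (Disjoint⇒∣p∪q∣≡∣p∣+∣q∣ X#Y) ⟩
      ∣ X ∪ Y ∣           ≡⟨ sym (Circuit⇒1+r≡∣∣ X∪Y-circuit) ⟩
      suc (r (X ∪ Y))     ∎)
      where open ≡-Reasoning

lemma2p7 : {n : ℕ} (M : Matroid n) (A A' B' : Subset n) →
    Exact3Sep M A →
    Strand M A (∁ A) A' →
    Strand M (∁ A) A B' →
    (⊓ M A' B' ≡ 1) ⇔ Circuit M (A' ∪ B')
lemma2p7 M A A' B' _ = ⊓-strands≡1⇔Circuit M x∈p⇒x∉∁p
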